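{- Let $G$ be a median graph and $H$ a gated subgraph of $G$, and run the BFS traversal of $G$ with respect to $H$, writing $\mathrm{fib}(v)$ for the value called $\mathrm{closest}(v)$. Then for every vertex $v$ of $G$, $\mathrm{fib}(v)$ is the gate of $v$ in $H$ and $d(v)=d_G(v,\mathrm{fib}(v))$. Moreover, for each $x\in V(H)$, the vertex set of the tree $T(x)$ coincides with the fiber $F(x)$.
   Context: $d_G$ is shortest-path distance, $I(a,b)=\{t: d_G(a,t)+d_G(t,b)=d_G(a,b)\}$; $G$ is median if $I(a,b)\cap I(b,c)\cap I(c,a)$ is a single vertex for all $a,b,c$. $H$ is gated if every vertex $v$ has a vertex $v'\in V(H)$ (its gate) with $d_G(v,u)=d_G(v,v')+d_G(v',u)$ for all $u\in V(H)$; the fiber $F(x)$ of $x\in V(H)$ is the set of vertices whose gate is $x$. The BFS traversal of $G$ with respect to $H$: a FIFO queue $Q$ initially contains all vertices $x$ of $H$, with $\mathrm{fib}(x)=x$, $d(x)=0$, $f(x)$ null, marked discovered; repeatedly remove the head $u$ of $Q$ and for every undiscovered neighbor $v$ of $u$ mark it discovered, append it to $Q$, and set $f(v)=u$, $d(v)=d(u)+1$, $\mathrm{fib}(v)=\mathrm{fib}(u)$. For $x\in V(H)$, $T(x)$ is the tree consisting of all vertices $v$ with $\mathrm{fib}(v)=x$ and the edges $vf(v)$ between them. -}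

module Defs where

open import Data.Nat using (ℕ; zero; suc; _+_; _≤_)
open import Data.Fin using (Fin; _≟_)
open import Data.Bool using (Bool; true; false; if_then_else_)
open import Data.Maybe using (Maybe; just; nothing)
open import Data.List using (List; []; _∷_; _++_; [_]; foldl)
open import Data.List.Membership.Propositional using (_∈_)
import Data.List.Membership.DecPropositional
open import Data.List.Relation.Unary.Unique.Propositional using (Unique)
open import Data.Product using (Σ; _×_; ∃; _,_)
open import Relation.Nullary using (¬_; does)
open import Relation.Binary.PropositionalEquality using (_≡_)
open import Function using (_⇔_)

Edge : ∀ {n} → (Fin n → List (Fin n)) → Fin n → Fin n → Set
Edge adj u v = v ∈ adj u

record IsSimpleGraph {n : ℕ} (adj : Fin n → List (Fin n)) : Set where
  field
    symmetric   : ∀ u v → Edge adj u v → Edge adj v u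
    irreflexive : ∀ u → ¬ Edge adj u u
    noDup       : ∀ u → Unique (adj u)

data Walk {n} (adj : Fin n → List (Fin n)) : Fin n → Fin n → ℕ → Set where
  here  : ∀ a → Walk adj a a 0
  there : ∀ {a b c k} → Edge adj a b → Walk adj b c k → Walk adj a c (suc k)

Dist : ∀ {n} → (Fin n → List (Fin n)) → Fin n → Fin n → ℕ → Set
Dist adj a b k = Walk adj a b k × (∀ m → Walk adj a b m → k ≤ m)

InInterval : ∀ {n} → (Fin n → List (Fin n)) → Fin n → Fin n → Fin n → Set
InInterval adj a b t =
  Σ ℕ λ k₁ → Σ ℕ λ k₂ → Σ ℕ λ k₃ →
    Dist adj a t k₁ × Dist adj t b k₂ × Dist adj a b k₃ × (k₁ + k₂ ≡ k₃)

IsMedian : ∀ {n} → (Fin n → List (Fin n)) → Set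
IsMedian adj = ∀ a b c → Σ _ λ m →
  (InInterval adj a b m × InInterval adj b c m × InInterval adj c a m) ×
  (∀ t → InInterval adj a b t → InInterval adj b c t → InInterval adj c a t → t ≡ m)

IsGate : ∀ {n} → (Fin n → List (Fin n)) → List (Fin n) → Fin n → Fin n → Set
IsGate adj hs v v' = v' ∈ hs ×
  (∀ u → u ∈ hs → ∀ k₁ k₂ k₃ → Dist adj v u k₁ → Dist adj v v' k₂ → Dist adj v' u k₃ →
     k₁ ≡ k₂ + k₃)

IsGated : ∀ {n} → (Fin n → List (Fin n)) → List (Fin n) → Set
IsGated adj hs = ∀ v → Σ _ λ v' → IsGate adj hs v v'

InFiber : ∀ {n} → (Fin n → List (Fin n)) → List (Fin n) → Fin n → Fin n → Set
InFiber adj hs x v = IsGate adj hs v x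

record BFSState (n : ℕ) : Set where
  field
    disc  : Fin n → Bool
    fib   : Fin n → Fin n
    dist  : Fin n → ℕ
    par   : Fin n → Maybe (Fin n)
    queue : List (Fin n)
open BFSState public

update : ∀ {n} {A : Set} → (Fin n → A) → Fin n → A → Fin n → A
update f v x w = if does (w ≟ v) then x else f w

initState : ∀ {n} → List (Fin n) → BFSState n
initState {n} hs = record
  { disc  = λ v → does (Data.List.Membership.DecPropositional._∈?_ (_≟_ {n}) v hs)
  ; fib   = λ v → v
  ; dist  = λ _ → 0
  ; par   = λ _ → nothing
  ; queue = hs
  }

visit : ∀ {n} → Fin n → BFSState n → Fin n → BFSState n
visit u s v with disc s v
... | true  = s
... | false = record
  { disc  = update (disc s) v true
  ; fib   = update (fib s) v (fib s u)
  ; dist  = update (dist s) v (suc (dist s u))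
  ; par   = update (par s) v (just u)
  ; queue = queue s ++ [ v ]
  }

bfsStep : ∀ {n} → (Fin n → List (Fin n)) → BFSState n → BFSState n
bfsStep adj s with queue s
... | []     = s
... | u ∷ q  = foldl (visit u) (record s { queue = q }) (adj u)

iterateBFS : ∀ {n} → (Fin n → List (Fin n)) → ℕ → BFSState n → BFSState n
iterateBFS adj zero    s = s
iterateBFS adj (suc k) s = iterateBFS adj k (bfsStep adj s)

-- Each vertex enters the queue at most once, so n dequeue steps run the
-- traversal to completion (further steps are no-ops on an empty queue).
runBFS : ∀ {n} → (Fin n → List (Fin n)) → List (Fin n) → BFSState n
runBFS {n} adj hs = iterateBFS adj n (initState hs)

module Submission where

open import Defs
open import Data.Nat using (ℕ; zero; suc; _+_; _≤_; _<_; s≤s⁻¹)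
open import Data.Nat.Properties hiding (_≟_)
open import Data.Fin using (Fin; _≟_)
open import Data.Bool using (Bool; true; false; if_then_else_)
open import Data.Maybe using (just)
open import Data.List using (List; []; _∷_; _++_; [_]; foldl; length; allFin)
open import Data.List.Membership.Propositional using (_∈_)
open import Data.List.Membership.Propositional.Properties using (∈-++⁺ˡ; ∈-++⁺ʳ; ∈-++⁻; ∈-allFin)
import Data.List.Membership.DecPropositional
open import Data.List.Relation.Unary.Any using (here; there)
open import Data.List.Relation.Unary.All as All using (All; []; _∷_)
open import Data.List.Relation.Unary.All.Properties using (++⁺)
open import Data.List.Relation.Unary.AllPairs using (_∷_)
open import Data.List.Relation.Unary.Unique.Propositional using (Unique)
open import Data.List.Relation.Unary.Unique.Propositional.Properties using (allFin⁺)
open import Data.List.Properties using (++-assoc; ++-identityʳ; length-++; length-tabulate; ∷-injective)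
open import Data.Product using (Σ; _×_; _,_; proj₁; proj₂)
open import Data.Sum using (inj₁; inj₂)
open import Data.Empty using (⊥-elim)
open import Relation.Nullary using (¬_; does; yes; no; Dec)
open import Relation.Nullary.Decidable using (dec-true; dec-false)
open import Relation.Binary.PropositionalEquality hiding ([_])
open import Function using (_⇔_; mk⇔)

-- Let δ(v) = d_G(v, V(H)).  A median graph is connected.  For a gated H the distance
--      to the gate, d_G(v, gate v), is δ(v) (record IsDistanceTo), and a
--      vertex of H at distance δ(v) from v is the gate, so gates are unique.
--   2. Multi-source BFS is correct in every symmetric graph in which δ is
--      defined (module BFS): afterwards every vertex is discovered, fib(v)
--      lies in H and d(v) = δ(v) = d_G(v, fib v).  The invariant is the
--      classical layering: the queue holds vertices of some level L followed
--      by vertices of level L+1, every vertex below level L is discovered and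
--      dequeued, and dequeued vertices have all neighbours discovered.  The
--      potential #undiscovered + queue length starts at n and drops by one per
--      round, so the n rounds of runBFS empty the queue.
--   3. The corollary: fib(v) is a vertex of H at distance δ(v), hence the
--      gate, and {v : fib v = x} (the vertex set of T(x)) is the fiber F(x).

walk-length-zero : ∀ {n} {adj : Fin n → List (Fin n)} {a b k} →
  Walk adj a b k → k ≡ 0 → a ≡ b
walk-length-zero (here _) _ = refl

-- A median graph is connected: the median of a, b, a lies on a geodesic
-- from a to b, whose length is therefore d(a, b).
median⇒connected : ∀ {n} {adj : Fin n → List (Fin n)} →
  IsMedian adj → ∀ a b → Σ ℕ (Dist adj a b)
median⇒connected med a b with med a b a
... | _ , ((_ , _ , k , _ , _ , d , _) , _) , _ = k , d

record IsDistanceTo {n} (adj : Fin n → List (Fin n)) (hs : List (Fin n))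
                    (δ : Fin n → ℕ) : Set where
  field
    nearest : ∀ v → Σ (Fin n) λ x → x ∈ hs × Walk adj v x (δ v)
    minimal : ∀ {v x m} → x ∈ hs → Walk adj v x m → δ v ≤ m

module DistanceTo {n} {adj : Fin n → List (Fin n)} {hs : List (Fin n)}
  {δ : Fin n → ℕ} (isDist : IsDistanceTo adj hs δ) where

  open IsDistanceTo isDist public

  zero-on-sources : ∀ {v} → v ∈ hs → δ v ≡ 0
  zero-on-sources v∈hs = n≤0⇒n≡0 (minimal v∈hs (here _))

  zero⇒source : ∀ {v} → δ v ≡ 0 → v ∈ hs
  zero⇒source {v} δv≡0 with nearest v
  ... | x , x∈hs , W = subst (_∈ hs) (sym (walk-length-zero W δv≡0)) x∈hs

  edge-bound : ∀ {v w} → Edge adj v w → δ v ≤ suc (δ w)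
  edge-bound {w = w} e with nearest w
  ... | x , x∈hs , W = minimal x∈hs (there e W)

  predecessor : ∀ {v k} → δ v ≡ suc k → Σ (Fin n) λ w → Edge adj v w × δ w ≡ k
  predecessor {v} {k} δv≡1+k with nearest v
  ... | x , x∈hs , W = step (subst (Walk adj v x) δv≡1+k W)
    where
    step : Walk adj v x (suc k) → Σ (Fin n) λ w → Edge adj v w × δ w ≡ k
    step (there {b = w} e W′) =
      w , e , ≤-antisym (minimal x∈hs W′) (s≤s⁻¹ (subst (_≤ suc (δ w)) δv≡1+k (edge-bound e)))

module Gates {n} {adj : Fin n → List (Fin n)} {hs : List (Fin n)}
  (connected : ∀ a b → Σ ℕ (Dist adj a b)) (gated : IsGated adj hs) where

  gate : Fin n → Fin n
  gate v = proj₁ (gated v)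

  gate-spec : ∀ v → IsGate adj hs v (gate v)
  gate-spec v = proj₂ (gated v)

  δ : Fin n → ℕ
  δ v = proj₁ (connected v (gate v))

  dist-gate : ∀ v → Dist adj v (gate v) (δ v)
  dist-gate v = proj₂ (connected v (gate v))

  -- The gate is a nearest vertex of H: d(v,u) = d(v,gate v) + d(gate v,u).
  δ-isDistanceTo : IsDistanceTo adj hs δ
  δ-isDistanceTo = record
    { nearest = λ v → gate v , proj₁ (gate-spec v) , proj₁ (dist-gate v)
    ; minimal = minimal
    }
    where
    minimal : ∀ {v u m} → u ∈ hs → Walk adj v u m → δ v ≤ m
    minimal {v} {u} {m} u∈hs W with connected v u | connected (gate v) u
    ... | k₁ , d₁ | k₃ , d₃ = begin
      δ v       ≤⟨ m≤m+n (δ v) k₃ ⟩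
      δ v + k₃  ≡⟨ proj₂ (gate-spec v) u u∈hs k₁ (δ v) k₃ d₁ (dist-gate v) d₃ ⟨
      k₁        ≤⟨ proj₂ d₁ m W ⟩
      m         ∎
      where open ≤-Reasoning

  nearest-is-gate : ∀ {v x} → x ∈ hs → Dist adj v x (δ v) → gate v ≡ x
  nearest-is-gate {v} {x} x∈hs dvx with connected (gate v) x
  ... | k , d = walk-length-zero (proj₁ d) k≡0
    where
    split : δ v ≡ δ v + k
    split = proj₂ (gate-spec v) x x∈hs (δ v) (δ v) k dvx (dist-gate v) d
    k≡0 : k ≡ 0
    k≡0 = +-cancelˡ-≡ (δ v) k 0 (trans (sym split) (sym (+-identityʳ (δ v))))

  -- Every gate of v is the chosen one: it lies at distance δ v from v.
  gate-unique : ∀ {v a} → IsGate adj hs v a → gate v ≡ a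
  gate-unique {v} {a} (a∈hs , a-gate) with connected v a | connected a (gate v)
  ... | k , dva | k′ , dag = nearest-is-gate a∈hs (subst (Dist adj v a) k≡δv dva)
    where
    split : δ v ≡ k + k′
    split = a-gate (gate v) (proj₁ (gate-spec v)) (δ v) k k′ (dist-gate v) dva dag
    k≡δv : k ≡ δ v
    k≡δv = ≤-antisym (subst (k ≤_) (sym split) (m≤m+n k k′))
                     (IsDistanceTo.minimal δ-isDistanceTo a∈hs (proj₁ dva))

-- Number of elements of a list on which a Boolean predicate is false; it
-- counts the undiscovered vertices in the termination argument.
countFalse : ∀ {A : Set} → (A → Bool) → List A → ℕ
countFalse f []       = 0
countFalse f (x ∷ xs) = (if f x then 0 else 1) + countFalse f xs

countFalse-const : ∀ {A : Set} (xs : List A) → countFalse (λ _ → false) xs ≡ length xs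
countFalse-const []       = refl
countFalse-const (x ∷ xs) = cong suc (countFalse-const xs)

countFalse-agree : ∀ {A : Set} (f h : A → Bool) v xs → All (λ w → ¬ w ≡ v) xs →
  (∀ w → ¬ w ≡ v → h w ≡ f w) → countFalse h xs ≡ countFalse f xs
countFalse-agree f h v []       _        _     = refl
countFalse-agree f h v (x ∷ xs) (x≢v ∷ ps) agree
  rewrite agree x x≢v = cong (_ +_) (countFalse-agree f h v xs ps agree)

countFalse-flip : ∀ {A : Set} (f h : A → Bool) v xs → Unique xs → v ∈ xs →
  f v ≡ false → h v ≡ true → (∀ w → ¬ w ≡ v → h w ≡ f w) →
  suc (countFalse h xs) ≡ countFalse f xs
countFalse-flip f h v (x ∷ xs) (x∉xs ∷ _) (here refl) fv hv agree rewrite fv | hv =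
  cong suc (countFalse-agree f h v xs (All.map (λ x≢w w≡x → x≢w (sym w≡x)) x∉xs) agree)
countFalse-flip f h v (x ∷ xs) (x∉xs ∷ uxs) (there v∈xs) fv hv agree
  rewrite agree x (λ x≡v → All.lookup x∉xs v∈xs x≡v) =
  trans (sym (+-suc _ _)) (cong (_ +_) (countFalse-flip f h v xs uxs v∈xs fv hv agree))

update-same : ∀ {n} {A : Set} (f : Fin n → A) v x → update f v x v ≡ x
update-same f v x rewrite dec-true (v ≟ v) refl = refl

update-other : ∀ {n} {A : Set} (f : Fin n → A) v x {w} → ¬ w ≡ v → update f v x w ≡ f w
update-other f v x {w} w≢v rewrite dec-false (w ≟ v) w≢v = refl

discover : ∀ {n} → BFSState n → Fin n → Fin n → BFSState n
discover t u v = record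
  { disc  = update (disc t) v true
  ; fib   = update (fib t) v (fib t u)
  ; dist  = update (dist t) v (suc (dist t u))
  ; par   = update (par t) v (just u)
  ; queue = queue t ++ [ v ]
  }

visit-discovered : ∀ {n} (u : Fin n) t v → disc t v ≡ true → visit u t v ≡ t
visit-discovered u t v eq rewrite eq = refl

visit-fresh : ∀ {n} (u : Fin n) t v → disc t v ≡ false → visit u t v ≡ discover t u v
visit-fresh u t v eq rewrite eq = refl

module Rounds {n} (adj : Fin n → List (Fin n)) where

  step-dequeue : ∀ s u q → queue s ≡ u ∷ q →
    bfsStep adj s ≡ foldl (visit u) (record s { queue = q }) (adj u)
  step-dequeue s u q eq rewrite eq = refl

  iterate-idle : ∀ k s → queue s ≡ [] → iterateBFS adj k s ≡ s
  iterate-idle zero    s eq = refl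
  iterate-idle (suc k) s eq rewrite eq = iterate-idle k s eq

module BFS {n} (adj : Fin n → List (Fin n)) (hs : List (Fin n))
  (symmetric : ∀ u v → Edge adj u v → Edge adj v u) (unique-hs : Unique hs)
  {δ : Fin n → ℕ} (isDist : IsDistanceTo adj hs δ) where

  open DistanceTo isDist
  open Rounds adj
  open Data.List.Membership.DecPropositional (_≟_ {n}) using (_∈?_)

  Sound : BFSState n → Fin n → Set
  Sound t v = fib t v ∈ hs × Walk adj v (fib t v) (dist t v) × dist t v ≡ δ v

  Finished : BFSState n → Fin n → Set
  Finished t w = disc t w ≡ true × ¬ w ∈ queue t

  Grows : BFSState n → BFSState n → Set
  Grows t t′ = ∀ w → disc t w ≡ true → disc t′ w ≡ true

  -- Undiscovered vertices plus queue length; each round lowers it by one.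
  potential : BFSState n → ℕ
  potential t = countFalse (disc t) (allFin n) + length (queue t)

  -- If everything below level L is finished and finished vertices below L
  -- have discovered neighbours, then everything up to level L is discovered:
  -- follow a predecessor down one level.
  discovered-up-to : ∀ t L → (∀ v → v ∈ hs → disc t v ≡ true) →
    (∀ w → δ w < L → Finished t w) →
    (∀ a b → δ a < L → Finished t a → Edge adj a b → disc t b ≡ true) →
    ∀ w → δ w ≤ L → disc t w ≡ true
  discovered-up-to t L sources below closed w δw≤L = by-level (δ w) refl δw≤L
    where
    by-level : ∀ k → δ w ≡ k → k ≤ L → disc t w ≡ true
    by-level zero    δw≡0 _ = sources w (zero⇒source δw≡0)
    by-level (suc k) δw≡1+k 1+k≤L with predecessor δw≡1+k
    ... | x , wx , δx≡k = closed x w δx<L (below x δx<L) (symmetric w x wx)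
      where
      δx<L : δ x < L
      δx<L = subst (_< L) (sym δx≡k) 1+k≤L

  record Invariant (s : BFSState n) : Set where
    field
      sources-discovered : ∀ v → v ∈ hs → disc s v ≡ true
      sound              : ∀ v → disc s v ≡ true → Sound s v
      queued-discovered  : ∀ v → v ∈ queue s → disc s v ≡ true
      closed             : ∀ a b → Finished s a → Edge adj a b → disc s b ≡ true
      level              : ℕ
      front back         : List (Fin n)
      layered            : queue s ≡ front ++ back
      front-level        : All (λ x → δ x ≡ level) front
      back-level         : All (λ x → δ x ≡ suc level) back
      below-finished     : ∀ w → δ w < level → Finished s w

  record HeadLayer (s : BFSState n) (u : Fin n) (rest : List (Fin n)) : Set where
    field
      level          : ℕ
      front back     : List (Fin n)
      layered        : rest ≡ front ++ back
      head-level     : δ u ≡ level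
      front-level    : All (λ x → δ x ≡ level) front
      back-level     : All (λ x → δ x ≡ suc level) back
      below-finished : ∀ w → δ w < level → Finished s w

  -- If the level-L part of the queue is empty, the current level becomes L+1:
  -- level-L vertices are all discovered, and none is queued.
  head-layer : ∀ s u rest → Invariant s → queue s ≡ u ∷ rest → HeadLayer s u rest
  head-layer s u rest inv q≡u∷rest = from-front I.front I.layered I.front-level
    where
    module I = Invariant inv
    from-front : ∀ xs → queue s ≡ xs ++ I.back → All (λ x → δ x ≡ I.level) xs →
      HeadLayer s u rest
    from-front (x ∷ xs) q≡ (δx ∷ δxs) with ∷-injective (trans (sym q≡u∷rest) q≡)
    ... | refl , rest≡ = record
      { level = I.level ; front = xs ; back = I.back ; layered = rest≡
      ; head-level = δx ; front-level = δxs ; back-level = I.back-level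
      ; below-finished = I.below-finished }
    from-front [] q≡ [] = record
      { level = suc I.level ; front = rest ; back = [] ; layered = sym (++-identityʳ rest)
      ; head-level = All.head all-next ; front-level = All.tail all-next
      ; back-level = [] ; below-finished = below-next }
      where
      all-next : All (λ x → δ x ≡ suc I.level) (u ∷ rest)
      all-next = subst (All (λ x → δ x ≡ suc I.level)) (trans (sym q≡) q≡u∷rest) I.back-level
      not-queued : ∀ w → δ w ≡ I.level → ¬ w ∈ queue s
      not-queued w δw w∈q = 1+n≢n (trans (sym (All.lookup I.back-level (subst (w ∈_) q≡ w∈q))) δw)
      below-next : ∀ w → δ w < suc I.level → Finished s w
      below-next w δw<1+L with m<1+n⇒m<n∨m≡n δw<1+L
      ... | inj₁ δw<L = I.below-finished w δw<L
      ... | inj₂ δw≡L =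
        discovered-up-to s I.level I.sources-discovered I.below-finished
          (λ a b _ → I.closed a b) w (≤-reflexive δw≡L) ,
        not-queued w δw≡L

  module Scanning (u : Fin n) (L : ℕ) (δu≡L : δ u ≡ L) (rest : List (Fin n)) (M : ℕ) where

    record ScanInvariant (t : BFSState n) : Set where
      field
        sources-discovered : ∀ v → v ∈ hs → disc t v ≡ true
        sound              : ∀ v → disc t v ≡ true → Sound t v
        queued-discovered  : ∀ v → v ∈ queue t → disc t v ≡ true
        closed-but-head    : ∀ a b → Finished t a → ¬ a ≡ u → Edge adj a b → disc t b ≡ true
        new                : List (Fin n)
        queue-shape        : queue t ≡ rest ++ new
        new-level          : All (λ x → δ x ≡ suc L) new
        below-finished     : ∀ w → δ w < L → Finished t w
        head-discovered    : disc t u ≡ true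
        potential-fixed    : potential t ≡ M

    module Discover (t : BFSState n) (v : Fin n) (uv : Edge adj u v)
      (fresh : disc t v ≡ false) (scan : ScanInvariant t) where

      open ScanInvariant scan
      t′ = discover t u v

      grows : Grows t t′
      grows w p with w ≟ v
      ... | yes refl = refl
      ... | no _     = p

      -- v lies one level above u: it is at most one above by the edge, and
      -- everything up to level L was discovered already.
      level-v : δ v ≡ suc L
      level-v with δ v ≤? L
      ... | no δv≰L = ≤-antisym (subst (λ z → δ v ≤ suc z) δu≡L (edge-bound (symmetric u v uv)))
                                (≰⇒> δv≰L)
      ... | yes δv≤L = ⊥-elim (true≢false (trans (sym low-discovered) fresh))
        where
        closed-below : ∀ a b → δ a < L → Finished t a → Edge adj a b → disc t b ≡ true
        closed-below a b δa<L fin = closed-but-head a b fin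
          (λ a≡u → <-irrefl (trans (cong δ a≡u) δu≡L) δa<L)
        low-discovered : disc t v ≡ true
        low-discovered = discovered-up-to t L sources-discovered below-finished closed-below v δv≤L
        true≢false : ¬ true ≡ false
        true≢false ()

      sound′ : ∀ w → disc t′ w ≡ true → Sound t′ w
      sound′ w p with w ≟ v
      ... | yes refl with sound u head-discovered
      ...   | fib-u∈hs , walk-u , dist-u≡δu =
        fib-u∈hs , there (symmetric u v uv) walk-u ,
        trans (cong suc (trans dist-u≡δu δu≡L)) (sym level-v)
      sound′ w p | no _ = sound w p

      queued′ : ∀ w → w ∈ queue t′ → disc t′ w ≡ true
      queued′ w w∈q with ∈-++⁻ (queue t) w∈q
      ... | inj₁ w∈q₀        = grows w (queued-discovered w w∈q₀)
      ... | inj₂ (here refl) = update-same (disc t) v true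

      closed′ : ∀ a b → Finished t′ a → ¬ a ≡ u → Edge adj a b → disc t′ b ≡ true
      closed′ a b (p , a∉q) a≢u ab with a ≟ v
      ... | yes refl = ⊥-elim (a∉q (∈-++⁺ʳ (queue t) (here refl)))
      ... | no _     = grows b (closed-but-head a b (p , λ a∈q → a∉q (∈-++⁺ˡ a∈q)) a≢u ab)

      below′ : ∀ w → δ w < L → Finished t′ w
      below′ w δw<L = grows w (proj₁ (below-finished w δw<L)) , not-queued
        where
        not-queued : ¬ w ∈ queue t′
        not-queued w∈q with ∈-++⁻ (queue t) w∈q
        ... | inj₁ w∈q₀        = proj₂ (below-finished w δw<L) w∈q₀
        ... | inj₂ (here refl) = <-irrefl refl (<-trans δw<L (subst (L <_) (sym level-v) (n<1+n L)))

      -- One vertex stops being undiscovered and one enters the queue.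
      potential′ : potential t′ ≡ M
      potential′ = begin
        countFalse (disc t′) (allFin n) + length (queue t ++ [ v ])
          ≡⟨ cong (countFalse (disc t′) (allFin n) +_)
                  (trans (length-++ (queue t)) (+-comm (length (queue t)) 1)) ⟩
        countFalse (disc t′) (allFin n) + suc (length (queue t))
          ≡⟨ +-suc _ _ ⟩
        suc (countFalse (disc t′) (allFin n)) + length (queue t)
          ≡⟨ cong (_+ length (queue t)) one-fewer ⟩
        potential t
          ≡⟨ potential-fixed ⟩
        M ∎
        where
        open ≡-Reasoning
        one-fewer : suc (countFalse (disc t′) (allFin n)) ≡ countFalse (disc t) (allFin n)
        one-fewer = countFalse-flip (disc t) (disc t′) v (allFin n) (allFin⁺ n) (∈-allFin v)
          fresh (update-same (disc t) v true) (λ w w≢v → update-other (disc t) v true w≢v)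

      invariant′ : ScanInvariant t′
      invariant′ = record
        { sources-discovered = λ w w∈hs → grows w (sources-discovered w w∈hs)
        ; sound              = sound′
        ; queued-discovered  = queued′
        ; closed-but-head    = closed′
        ; new                = new ++ [ v ]
        ; queue-shape        = trans (cong (_++ [ v ]) queue-shape) (++-assoc rest new [ v ])
        ; new-level          = ++⁺ new-level (level-v ∷ [])
        ; below-finished     = below′
        ; head-discovered    = grows u head-discovered
        ; potential-fixed    = potential′
        }

    visit-preserves : ∀ t v → Edge adj u v → ScanInvariant t →
      ScanInvariant (visit u t v) × Grows t (visit u t v) × disc (visit u t v) v ≡ true
    visit-preserves t v uv scan = by-status (disc t v) refl
      where
      Result : BFSState n → Set
      Result t′ = ScanInvariant t′ × Grows t t′ × disc t′ v ≡ true
      by-status : ∀ b → disc t v ≡ b → Result (visit u t v)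
      by-status true  seen  = subst Result (sym (visit-discovered u t v seen)) (scan , (λ _ p → p) , seen)
      by-status false fresh = subst Result (sym (visit-fresh u t v fresh))
        (D.invariant′ , D.grows , update-same (disc t) v true)
        where module D = Discover t v uv fresh scan

    scan-preserves : ∀ vs t → (∀ v → v ∈ vs → Edge adj u v) → ScanInvariant t →
      ScanInvariant (foldl (visit u) t vs) × Grows t (foldl (visit u) t vs) ×
      (∀ v → v ∈ vs → disc (foldl (visit u) t vs) v ≡ true)
    scan-preserves []       t _     scan = scan , (λ _ p → p) , λ _ ()
    scan-preserves (v ∷ vs) t edges scan
      with visit-preserves t v (edges v (here refl)) scan
    ... | scan₁ , grows₁ , v-disc
      with scan-preserves vs (visit u t v) (λ w w∈vs → edges w (there w∈vs)) scan₁
    ...   | scan₂ , grows₂ , vs-disc =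
      scan₂ , (λ w p → grows₂ w (grows₁ w p)) ,
      λ { w (here refl) → grows₂ w v-disc ; w (there w∈vs) → vs-disc w w∈vs }

  round-preserves : ∀ s u rest → Invariant s → queue s ≡ u ∷ rest →
    Invariant (bfsStep adj s) × suc (potential (bfsStep adj s)) ≡ potential s
  round-preserves s u rest inv q≡u∷rest =
    subst (λ t → Invariant t × suc (potential t) ≡ potential s)
          (sym (step-dequeue s u rest q≡u∷rest)) (inv₁ , potential-drops)
    where
    module I = Invariant inv
    module H = HeadLayer (head-layer s u rest inv q≡u∷rest)
    open Scanning u H.level H.head-level rest (countFalse (disc s) (allFin n) + length rest)
    t₀ : BFSState n
    t₀ = record s { queue = rest }
    from-rest : ∀ {v} → v ∈ rest → v ∈ queue s
    from-rest v∈rest = subst (_ ∈_) (sym q≡u∷rest) (there v∈rest)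
    scan₀ : ScanInvariant t₀
    scan₀ = record
      { sources-discovered = I.sources-discovered
      ; sound              = I.sound
      ; queued-discovered  = λ v v∈rest → I.queued-discovered v (from-rest v∈rest)
      ; closed-but-head    = λ a b (p , a∉rest) a≢u → I.closed a b (p , not-queued a∉rest a≢u)
      ; new                = []
      ; queue-shape        = sym (++-identityʳ rest)
      ; new-level          = []
      ; below-finished     = λ w δw<L → proj₁ (H.below-finished w δw<L) ,
                                         λ w∈rest → proj₂ (H.below-finished w δw<L) (from-rest w∈rest)
      ; head-discovered    = I.queued-discovered u (subst (_ ∈_) (sym q≡u∷rest) (here refl))
      ; potential-fixed    = refl
      }
      where
      not-queued : ∀ {a} → ¬ a ∈ rest → ¬ a ≡ u → ¬ a ∈ queue s
      not-queued a∉rest a≢u a∈q with subst (_ ∈_) q≡u∷rest a∈q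
      ... | here a≡u     = a≢u a≡u
      ... | there a∈rest = a∉rest a∈rest
    t₁ = foldl (visit u) t₀ (adj u)
    scanned = scan-preserves (adj u) t₀ (λ _ uv → uv) scan₀
    module S = ScanInvariant (proj₁ scanned)
    inv₁ : Invariant t₁
    inv₁ = record
      { sources-discovered = S.sources-discovered
      ; sound              = S.sound
      ; queued-discovered  = S.queued-discovered
      ; closed             = closed
      ; level              = H.level
      ; front              = H.front
      ; back               = H.back ++ S.new
      ; layered            = trans S.queue-shape
                               (trans (cong (_++ S.new) H.layered) (++-assoc H.front H.back S.new))
      ; front-level        = H.front-level
      ; back-level         = ++⁺ H.back-level S.new-level
      ; below-finished     = S.below-finished
      }
      where
      -- u itself is closed because all its neighbours were just scanned.
      closed : ∀ a b → Finished t₁ a → Edge adj a b → disc t₁ b ≡ true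
      closed a b fin ab with a ≟ u
      ... | yes refl = proj₂ (proj₂ scanned) b ab
      ... | no a≢u   = S.closed-but-head a b fin a≢u ab
    potential-drops : suc (potential t₁) ≡ potential s
    potential-drops = trans (cong suc S.potential-fixed)
      (trans (sym (+-suc _ _)) (cong (λ q → countFalse (disc s) (allFin n) + length q) (sym q≡u∷rest)))

  rounds-complete : ∀ k s → Invariant s → potential s ≤ k →
    Invariant (iterateBFS adj k s) × queue (iterateBFS adj k s) ≡ []
  rounds-complete zero s inv p≤0 =
    inv , empty (queue s) (m+n≤o⇒n≤o (countFalse (disc s) (allFin n)) p≤0)
    where
    empty : ∀ (q : List (Fin n)) → length q ≤ 0 → q ≡ []
    empty []      _  = refl
    empty (_ ∷ _) ()
  rounds-complete (suc k) s inv p≤1+k = by-queue (queue s) refl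
    where
    by-queue : ∀ q → queue s ≡ q →
      Invariant (iterateBFS adj (suc k) s) × queue (iterateBFS adj (suc k) s) ≡ []
    by-queue [] q≡[] = subst (λ t → Invariant t × queue t ≡ [])
                             (sym (iterate-idle (suc k) s q≡[])) (inv , q≡[])
    by-queue (u ∷ rest) q≡u∷rest with round-preserves s u rest inv q≡u∷rest
    ... | inv₁ , drop =
      rounds-complete k (bfsStep adj s) inv₁ (s≤s⁻¹ (subst (_≤ suc k) (sym drop) p≤1+k))

  member : List (Fin n) → Fin n → Bool
  member ys v = does (v ∈? ys)

  -- Initially the potential is exactly n: hs is queued, the rest undiscovered.
  initial-potential : ∀ ys → Unique ys → countFalse (member ys) (allFin n) + length ys ≡ n
  initial-potential [] _ =
    trans (+-identityʳ _) (trans (countFalse-const (allFin n)) (length-tabulate (λ x → x)))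
  initial-potential (y ∷ ys) (y∉ys ∷ uys) =
    trans (+-suc _ _) (trans (cong (_+ length ys) one-fewer) (initial-potential ys uys))
    where
    agree : ∀ w → ¬ w ≡ y → member (y ∷ ys) w ≡ member ys w
    agree w w≢y = by-membership (w ∈? ys)
      where
      by-membership : Dec (w ∈ ys) → member (y ∷ ys) w ≡ member ys w
      by-membership (yes w∈ys) =
        trans (dec-true (w ∈? (y ∷ ys)) (there w∈ys)) (sym (dec-true (w ∈? ys) w∈ys))
      by-membership (no w∉ys) =
        trans (dec-false (w ∈? (y ∷ ys)) λ { (here w≡y) → w≢y w≡y ; (there w∈ys) → w∉ys w∈ys })
              (sym (dec-false (w ∈? ys) w∉ys))
    one-fewer : suc (countFalse (member (y ∷ ys)) (allFin n)) ≡ countFalse (member ys) (allFin n)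
    one-fewer = countFalse-flip (member ys) (member (y ∷ ys)) y (allFin n) (allFin⁺ n) (∈-allFin y)
      (dec-false (y ∈? ys) (λ y∈ys → All.lookup y∉ys y∈ys refl))
      (dec-true (y ∈? (y ∷ ys)) (here refl)) agree

  initial-invariant : Invariant (initState hs)
  initial-invariant = record
    { sources-discovered = λ v v∈hs → dec-true (v ∈? hs) v∈hs
    ; sound              = λ v p → let v∈hs = member-true v p in
                                   v∈hs , here v , sym (zero-on-sources v∈hs)
    ; queued-discovered  = λ v v∈hs → dec-true (v ∈? hs) v∈hs
    ; closed             = λ a b (p , a∉hs) _ → ⊥-elim (a∉hs (member-true a p))
    ; level              = 0
    ; front              = hs
    ; back               = []
    ; layered            = sym (++-identityʳ hs)
    ; front-level        = All.tabulate zero-on-sources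
    ; back-level         = []
    ; below-finished     = λ w ()
    }
    where
    member-true : ∀ v → member hs v ≡ true → v ∈ hs
    member-true v p with v ∈? hs
    ... | yes v∈hs = v∈hs

  final : BFSState n
  final = runBFS adj hs

  finished : Invariant final × queue final ≡ []
  finished = rounds-complete n (initState hs) initial-invariant
               (≤-reflexive (initial-potential hs unique-hs))

  module F = Invariant (proj₁ finished)

  -- With an empty queue, discovery propagates backwards along walks.
  reaches-discovered : ∀ {a c k} → Walk adj a c k → disc final c ≡ true → disc final a ≡ true
  reaches-discovered (here _)              p = p
  reaches-discovered {a} (there {b = b} ab W) p =
    F.closed b a (reaches-discovered W p , b∉queue) (symmetric a b ab)
    where
    b∉queue : ¬ b ∈ queue final
    b∉queue b∈q with subst (b ∈_) (proj₂ finished) b∈q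
    ... | ()

  -- Every vertex has a walk into hs, whose end was discovered initially.
  all-discovered : ∀ v → disc final v ≡ true
  all-discovered v with nearest v
  ... | x , x∈hs , W = reaches-discovered W (F.sources-discovered x x∈hs)

  all-sound : ∀ v → Sound final v
  all-sound v = F.sound v (all-discovered v)

  -- d(v) is the distance from v to fib(v), since no walk into hs is shorter.
  dist-to-fib : ∀ v → Dist adj v (fib final v) (dist final v)
  dist-to-fib v with all-sound v
  ... | fib∈hs , W , d≡δ = W , λ m W′ → subst (_≤ m) (sym d≡δ) (minimal fib∈hs W′)

corollary24 : (n : ℕ) (adj : Fin n → List (Fin n)) (hs : List (Fin n)) →
    IsSimpleGraph adj → IsMedian adj → Unique hs → IsGated adj hs →
    let s = runBFS adj hs in
    (∀ v → disc s v ≡ true × IsGate adj hs v (fib s v) × Dist adj v (fib s v) (dist s v)) ×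
    (∀ x → x ∈ hs → ∀ v → (disc s v ≡ true × fib s v ≡ x) ⇔ InFiber adj hs x v)
corollary24 n adj hs sg med unique-hs gated =
  (λ v → all-discovered v , fib-is-gate v , dist-to-fib v) ,
  λ x _ v → mk⇔ (λ (_ , fib≡x) → subst (IsGate adj hs v) fib≡x (fib-is-gate v))
                (λ x-gate → all-discovered v , trans (sym (gate≡fib v)) (gate-unique x-gate))
  where
  open Gates (median⇒connected med) gated
  open BFS adj hs (IsSimpleGraph.symmetric sg) unique-hs δ-isDistanceTo

  -- fib(v) is a vertex of H at distance δ(v) from v, hence the gate.
  gate≡fib : ∀ v → gate v ≡ fib final v
  gate≡fib v with all-sound v
  ... | fib∈hs , _ , d≡δ = nearest-is-gate fib∈hs (subst (Dist adj v (fib final v)) d≡δ (dist-to-fib v))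

  fib-is-gate : ∀ v → IsGate adj hs v (fib final v)
  fib-is-gate v = subst (IsGate adj hs v) (gate≡fib v) (gate-spec v)
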